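{- Let $\mathcal{MC}$ be the family of all $\exists$-saturated maximal $\mathsf{FOL\Box}$-consistent sets. For every formula $A$ of $\mathcal{L}(\forall,\Box)$ and all $\Gamma,\Delta\in\mathcal{MC}$: $\Box A\in\Gamma\iff\Box A\in\Delta$.
   Context: Language $\mathcal{L}(\forall,\Box)$: first-order language with identity $=$, predicate symbols, variables, no constants or function symbols, connectives $\neg,\to$, quantifier $\forall$, modal operator $\Box$ (arbitrary nesting); $\Diamond:=\neg\Box\neg$. A formula is $\Box$-free if it contains no $\Box$. $\mathsf{FOL}$ is the set of $\Box$-free theses of classical first-order logic with identity. An occurrence of $x$ in $A$ is $\forall\Box$-bound if it is in the scope of a quantifier on $x$ or inside the scope of some $\Box$; otherwise $\forall\Box$-free. $x$ is a $\forall\Box$-free variable of $A$ if it has a $\forall\Box$-free occurrence. $A(^y/_x)$ is the simultaneous replacement of every $\forall\Box$-free occurrence of $x$ by $y$, provided $y$ is not captured by a quantifier. $\mathsf{FOL\Box}$ is the smallest set of formulas containing all instances of propositional tautologies and all instances of: $\Box(A\to B)\to(\Box A\to\Box B)$; $\Box A\to A$; $\neg\Box A\to\Box\neg\Box A$; $\forall xA\to A(^y/_x)$ (admissible $\forall\Box$-free substitution); $\forall x(A\to B)\to(A\to\forall xB)$ if $x$ is not $\forall\Box$-free in $A$; $x=x$; $x=y\wedge A(x)\to A(y)$ for $\Box$-free $A$ (usual first-order identity axiom); $\Box A\to\forall xA$; $\neg\Box A$ for every $\Box$-free $A\notin\mathsf{FOL}$; closed under: $A\in\mathsf{FOL\Box}\Rightarrow\Box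 A\in\mathsf{FOL\Box}$, and modus ponens. A set $\Gamma$ is $\mathsf{FOL\Box}$-consistent if there is no finite $\{B_1,\dots,B_k\}\subseteq\Gamma$ with $\neg(B_1\wedge\dots\wedge B_k)\in\mathsf{FOL\Box}$; maximal consistent if consistent and no proper superset is consistent. $\Gamma$ is $\exists$-saturated if for every $\neg\forall xA\in\Gamma$ there is a variable $y$ with $A(^y/_x)$ admissible and $\neg A(^y/_x)\in\Gamma$. -}

module Defs where

open import Data.Nat using (ℕ; _≟_)
open import Data.Bool using (Bool; true; false; not; _∨_; if_then_else_)
open import Data.Vec using (Vec; map)
open import Data.Vec.Membership.Propositional using () renaming (_∈_ to _∈ᵥ_)
open import Data.List using (List; []; _∷_)
open import Data.Product using (_×_; Σ; ∃)
open import Data.Sum using (_⊎_)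
open import Data.Unit using (⊤)
open import Data.Empty using (⊥)
open import Relation.Nullary using (¬_; does)
open import Relation.Binary.PropositionalEquality using (_≡_)
open import Level using (Level; suc; zero)

Var : Set
Var = ℕ

-- Formulas of L(∀,□).  Predicate symbols are P^n_p (name p, arity n),
-- applied to n variables.  No constants, no function symbols.
infixr 5 _⇒_
data Formula : Set where
  pred : (p n : ℕ) → Vec Var n → Formula
  _≐_  : Var → Var → Formula
  ¬'_  : Formula → Formula
  _⇒_  : Formula → Formula → Formula
  ∀'   : Var → Formula → Formula
  □_   : Formula → Formula

_∧'_ : Formula → Formula → Formula
A ∧' B = ¬' (A ⇒ ¬' B)

◇_ : Formula → Formula
◇ A = ¬' (□ (¬' A))

⊤' : Formula
⊤' = (0 ≐ 0) ⇒ (0 ≐ 0)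

conj : List Formula → Formula
conj []      = ⊤'
conj (B ∷ []) = B
conj (B ∷ Bs) = B ∧' conj Bs

BoxFree : Formula → Set
BoxFree (pred p n xs) = ⊤
BoxFree (x ≐ y)       = ⊤
BoxFree (¬' A)        = BoxFree A
BoxFree (A ⇒ B)       = BoxFree A × BoxFree B
BoxFree (∀' x A)      = BoxFree A
BoxFree (□ A)         = ⊥

-- x is a ∀□-free variable of A (has an occurrence not bound by ∀x and not under □)
FreeIn : Var → Formula → Set
FreeIn x (pred p n xs) = x ∈ᵥ xs
FreeIn x (y ≐ z)       = (x ≡ y) ⊎ (x ≡ z)
FreeIn x (¬' A)        = FreeIn x A
FreeIn x (A ⇒ B)       = FreeIn x A ⊎ FreeIn x B
FreeIn x (∀' z A)      = ¬ (x ≡ z) × FreeIn x A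
FreeIn x (□ A)         = ⊥

rn : Var → Var → Var → Var
rn x y w = if does (w ≟ x) then y else w

_[_≔_] : Formula → Var → Var → Formula
pred p n xs [ x ≔ y ] = pred p n (map (rn x y) xs)
(u ≐ v)     [ x ≔ y ] = rn x y u ≐ rn x y v
(¬' A)      [ x ≔ y ] = ¬' (A [ x ≔ y ])
(A ⇒ B)     [ x ≔ y ] = (A [ x ≔ y ]) ⇒ (B [ x ≔ y ])
(∀' z A)    [ x ≔ y ] = if does (z ≟ x) then ∀' z A else ∀' z (A [ x ≔ y ])
(□ A)       [ x ≔ y ] = □ A

-- A(^y/_x) is admissible: no replaced occurrence of x gets captured by a ∀y
Admissible : Var → Var → Formula → Set
Admissible x y (pred p n xs) = ⊤
Admissible x y (u ≐ v)       = ⊤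
Admissible x y (¬' A)        = Admissible x y A
Admissible x y (A ⇒ B)       = Admissible x y A × Admissible x y B
Admissible x y (∀' z A)      =
  if does (z ≟ x) then ⊤
  else (if does (z ≟ y) then ¬ FreeIn x A else Admissible x y A)
Admissible x y (□ A)         = ⊤

-- Instances of propositional tautologies: true under every Boolean valuation
-- of the prime (non ¬/→) subformulas.
eval : (Formula → Bool) → Formula → Bool
eval v (¬' A)  = not (eval v A)
eval v (A ⇒ B) = not (eval v A) ∨ eval v B
eval v A       = v A

Taut : Formula → Set
Taut A = (v : Formula → Bool) → eval v A ≡ true

data FOLDer : Formula → Set where
  taut  : ∀ {A} → BoxFree A → Taut A → FOLDer A
  inst  : ∀ {x y A} → BoxFree A → Admissible x y A → FOLDer (∀' x A ⇒ (A [ x ≔ y ]))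
  dist  : ∀ {x A B} → BoxFree A → BoxFree B → ¬ FreeIn x A →
          FOLDer (∀' x (A ⇒ B) ⇒ (A ⇒ ∀' x B))
  refl≐ : ∀ {x} → FOLDer (x ≐ x)
  leib  : ∀ {z x y A} → BoxFree A → Admissible z x A → Admissible z y A →
          FOLDer (((x ≐ y) ∧' (A [ z ≔ x ])) ⇒ (A [ z ≔ y ]))
  mp    : ∀ {A B} → FOLDer (A ⇒ B) → FOLDer A → FOLDer B
  gen   : ∀ {x A} → FOLDer A → FOLDer (∀' x A)

FOL : Formula → Set
FOL A = BoxFree A × FOLDer A

data FOL□ : Formula → Set where
  taut  : ∀ {A} → Taut A → FOL□ A
  K     : ∀ {A B} → FOL□ (□ (A ⇒ B) ⇒ (□ A ⇒ □ B))
  T     : ∀ {A} → FOL□ (□ A ⇒ A)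
  five  : ∀ {A} → FOL□ (¬' (□ A) ⇒ □ (¬' (□ A)))
  inst  : ∀ {x y A} → Admissible x y A → FOL□ (∀' x A ⇒ (A [ x ≔ y ]))
  dist  : ∀ {x A B} → ¬ FreeIn x A → FOL□ (∀' x (A ⇒ B) ⇒ (A ⇒ ∀' x B))
  refl≐ : ∀ {x} → FOL□ (x ≐ x)
  leib  : ∀ {z x y A} → BoxFree A → Admissible z x A → Admissible z y A →
          FOL□ (((x ≐ y) ∧' (A [ z ≔ x ])) ⇒ (A [ z ≔ y ]))
  box∀  : ∀ {x A} → FOL□ (□ A ⇒ ∀' x A)
  nonFOL : ∀ {A} → BoxFree A → ¬ FOL A → FOL□ (¬' (□ A))
  nec   : ∀ {A} → FOL□ A → FOL□ (□ A)
  mp    : ∀ {A B} → FOL□ (A ⇒ B) → FOL□ A → FOL□ B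

FSet : Set₁
FSet = Formula → Set

_⊆_ : FSet → FSet → Set
Γ ⊆ Δ = ∀ {A} → Γ A → Δ A

-- finite subsets, as lists of members
AllIn : List Formula → FSet → Set
AllIn []       Γ = ⊤
AllIn (B ∷ Bs) Γ = Γ B × AllIn Bs Γ

Consistent : FSet → Set
Consistent Γ = (Bs : List Formula) → AllIn Bs Γ → ¬ FOL□ (¬' (conj Bs))

MaxConsistent : FSet → Set₁
MaxConsistent Γ = Consistent Γ × ((Δ : FSet) → Γ ⊆ Δ → Consistent Δ → Δ ⊆ Γ)

∃-Saturated : FSet → Set
∃-Saturated Γ = ∀ {x A} → Γ (¬' (∀' x A)) →
  Σ Var (λ y → Admissible x y A × Γ (¬' (A [ x ≔ y ])))

MC : FSet → Set₁
MC Γ = ∃-Saturated Γ × MaxConsistent Γ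

-- Every formula of L(∀,□) is provably equivalent in FOL□ to a □-free one:
-- innermost, a subformula □ B with B □-free is either provable (B ∈ FOL, by
-- necessitation) or refutable (B ∉ FOL, by the axiom ¬□B), so it can be
-- replaced by ⊤' or ¬⊤'.  Hence for every A, classically, either □A or ¬□A is
-- a theorem.  A theorem can be added to any consistent set, and a refutable
-- formula lies in no consistent set; so □A belongs either to every maximal
-- consistent set or to none.
module Submission where

open import Defs
open import Data.Bool using (Bool; true; false; not; _∧_; _∨_; if_then_else_)
open import Data.Bool.Properties using (∧-conicalˡ; ∧-conicalʳ)
open import Data.List using (List; []; _∷_)
open import Data.Nat using (ℕ; zero; suc; _≟_; _≡ᵇ_)
open import Data.Product using (_×_; Σ-syntax; _,_; proj₁; proj₂)
open import Data.Sum using (_⊎_; inj₁; inj₂)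
open import Data.Unit using (tt)
open import Data.Vec.Properties using (map-cong; map-id)
open import Function.Bundles using (_⇔_; mk⇔)
open import Relation.Nullary using (¬_; Dec; yes; no; does)
open import Relation.Nullary.Decidable using (¬¬-excluded-middle)
open import Relation.Binary.PropositionalEquality using (_≡_; refl; sym; trans; cong; cong₂; subst)

private variable
  A A' B B' C P Q : Formula
  x : Var

BoolFun : ℕ → Set
BoolFun zero    = Bool
BoolFun (suc n) = Bool → BoolFun n

Tautology : ∀ n → BoolFun n → Set
Tautology zero    b = b ≡ true
Tautology (suc n) f = ∀ a → Tautology n (f a)

allRows : ∀ n → BoolFun n → Bool
allRows zero    b = b
allRows (suc n) f = allRows n (f false) ∧ allRows n (f true)

-- Called as  truthTable n refl : the function f is recovered by unification
-- from the stated type, and refl evaluates the whole table.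
truthTable : ∀ n {f : BoolFun n} → allRows n f ≡ true → Tautology n f
truthTable zero    t       = t
truthTable (suc n) t false = truthTable n (∧-conicalˡ _ _ t)
truthTable (suc n) t true  = truthTable n (∧-conicalʳ _ _ t)

⇒-refl : FOL□ (A ⇒ A)
⇒-refl {A} = taut λ v → table (eval v A)
  where
  table : ∀ a → not a ∨ a ≡ true
  table = truthTable 1 refl

⇒-cong : FOL□ (A' ⇒ A) → FOL□ (B ⇒ B') → FOL□ ((A ⇒ B) ⇒ (A' ⇒ B'))
⇒-cong {A'} {A} {B} {B'} p q =
  mp (mp (taut λ v → table (eval v A) (eval v A') (eval v B) (eval v B')) p) q
  where
  table : ∀ a a' b b' →
          not (not a' ∨ a) ∨ (not (not b ∨ b') ∨ (not (not a ∨ b) ∨ (not a' ∨ b'))) ≡ true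
  table = truthTable 4 refl

infixr 9 _⨾_
_⨾_ : FOL□ (A ⇒ B) → FOL□ (B ⇒ C) → FOL□ (A ⇒ C)
p ⨾ q = mp (⇒-cong ⇒-refl q) p

contraposition : FOL□ (A ⇒ B) → FOL□ (¬' B ⇒ ¬' A)
contraposition {A} {B} p = mp (taut λ v → table (eval v A) (eval v B)) p
  where
  table : ∀ a b → not (not a ∨ b) ∨ (not (not b) ∨ not a) ≡ true
  table = truthTable 2 refl

weaken : FOL□ A → FOL□ (B ⇒ A)
weaken {A} {B} p = mp (taut λ v → table (eval v A) (eval v B)) p
  where
  table : ∀ a b → not a ∨ (not b ∨ a) ≡ true
  table = truthTable 2 refl

ex-falso : FOL□ (¬' A) → FOL□ (A ⇒ B)
ex-falso {A} {B} p = mp (taut λ v → table (eval v A) (eval v B)) p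
  where
  table : ∀ a b → not (not a) ∨ (not a ∨ b) ≡ true
  table = truthTable 2 refl

¬¬⊤' : FOL□ (¬' ¬' ⊤')
¬¬⊤' = taut λ v → table (v (0 ≐ 0))
  where
  table : ∀ t → not (not (not t ∨ t)) ≡ true
  table = truthTable 1 refl

∧-proj₁ : FOL□ (A ∧' B ⇒ A)
∧-proj₁ {A} {B} = taut λ v → table (eval v A) (eval v B)
  where
  table : ∀ a b → not (not (not a ∨ not b)) ∨ a ≡ true
  table = truthTable 2 refl

∧-proj₂ : FOL□ (A ∧' B ⇒ B)
∧-proj₂ {A} {B} = taut λ v → table (eval v A) (eval v B)
  where
  table : ∀ a b → not (not (not a ∨ not b)) ∨ b ≡ true
  table = truthTable 2 refl

∧-intro : FOL□ (A ⇒ B) → FOL□ (A ⇒ C) → FOL□ (A ⇒ B ∧' C)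
∧-intro {A} {B} {C} p q = mp (mp (taut λ v → table (eval v A) (eval v B) (eval v C)) p) q
  where
  table : ∀ a b c →
          not (not a ∨ b) ∨ (not (not a ∨ c) ∨ (not a ∨ not (not b ∨ not c))) ≡ true
  table = truthTable 3 refl

rn-self : ∀ x w → rn x x w ≡ w
rn-self x w = select (w ≟ x)
  where
  select : (d : Dec (w ≡ x)) → (if does d then x else w) ≡ w
  select (yes w≡x) = sym w≡x
  select (no _)    = refl

-- does (z ≟ x) computes to z ≡ᵇ x, so the ∀' cases below split on the latter.
[≔]-self : ∀ x A → A [ x ≔ x ] ≡ A
[≔]-self x (pred p n xs) = cong (pred p n) (trans (map-cong (rn-self x) xs) (map-id xs))
[≔]-self x (u ≐ w)       = cong₂ _≐_ (rn-self x u) (rn-self x w)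
[≔]-self x (¬' A)        = cong ¬'_ ([≔]-self x A)
[≔]-self x (A ⇒ B)       = cong₂ _⇒_ ([≔]-self x A) ([≔]-self x B)
[≔]-self x (∀' z A) with z ≡ᵇ x
... | true  = refl
... | false = cong (∀' z) ([≔]-self x A)
[≔]-self x (□ A)         = refl

admissible-self : ∀ x A → Admissible x x A
admissible-self x (pred p n xs) = tt
admissible-self x (u ≐ w)       = tt
admissible-self x (¬' A)        = admissible-self x A
admissible-self x (A ⇒ B)       = admissible-self x A , admissible-self x B
admissible-self x (∀' z A) with z ≡ᵇ x
... | true  = tt
... | false = admissible-self x A
admissible-self x (□ A)         = tt

∀-elim-self : FOL□ (∀' x A ⇒ A)
∀-elim-self {x} {A} =
  subst (λ F → FOL□ (∀' x A ⇒ F)) ([≔]-self x A) (inst (admissible-self x A))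

-- FOL□ has no generalisation rule; it is recovered from necessitation and □A ⇒ ∀x A.
generalise : FOL□ A → FOL□ (∀' x A)
generalise p = mp box∀ (nec p)

∀-mono : FOL□ (P ⇒ Q) → FOL□ (∀' x P ⇒ ∀' x Q)
∀-mono p = mp (dist (λ x-free → proj₁ x-free refl)) (generalise (∀-elim-self ⨾ p))

□-mono : FOL□ (P ⇒ Q) → FOL□ (□ P ⇒ □ Q)
□-mono p = mp K (nec p)

FOLDer⇒FOL□ : FOLDer A → FOL□ A
FOLDer⇒FOL□ (taut _ t)               = taut t
FOLDer⇒FOL□ (inst _ a)               = inst a
FOLDer⇒FOL□ (dist _ _ x-not-free)    = dist x-not-free
FOLDer⇒FOL□ refl≐                    = refl≐
FOLDer⇒FOL□ (leib {z} {x} {y} {A} b a₁ a₂) = leib {z} {x} {y} {A} b a₁ a₂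
FOLDer⇒FOL□ (mp p q)                 = mp (FOLDer⇒FOL□ p) (FOLDer⇒FOL□ q)
FOLDer⇒FOL□ (gen p)                  = generalise (FOLDer⇒FOL□ p)

infix 4 _≃_
_≃_ : Formula → Formula → Set
A ≃ B = FOL□ (A ⇒ B) × FOL□ (B ⇒ A)

¬-cong : A ≃ B → ¬' A ≃ ¬' B
¬-cong (p , q) = contraposition q , contraposition p

⇒-cong-≃ : A ≃ A' → B ≃ B' → (A ⇒ B) ≃ (A' ⇒ B')
⇒-cong-≃ (p , q) (r , s) = ⇒-cong q r , ⇒-cong p s

∀-cong : A ≃ B → ∀' x A ≃ ∀' x B
∀-cong (p , q) = ∀-mono p , ∀-mono q

□-cong : A ≃ B → □ A ≃ □ B
□-cong (p , q) = □-mono p , □-mono q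

Settled : Formula → Set
Settled A = FOL□ A ⊎ FOL□ (¬' A)

settled-≃ : A ≃ B → Settled B → Settled A
settled-≃ (p , q) (inj₁ ⊢B)  = inj₁ (mp q ⊢B)
settled-≃ (p , q) (inj₂ ⊢¬B) = inj₂ (mp (contraposition p) ⊢¬B)

settled-≃-boxFree : Settled A → Σ[ A' ∈ Formula ] BoxFree A' × A ≃ A'
settled-≃-boxFree (inj₁ ⊢A)  = ⊤' , (tt , tt) , weaken ⇒-refl , weaken ⊢A
settled-≃-boxFree (inj₂ ⊢¬A) = ¬' ⊤' , (tt , tt) , ex-falso ⊢¬A , ex-falso ¬¬⊤'

□-settled-boxFree : BoxFree B → ¬ ¬ Settled (□ B)
□-settled-boxFree {B} boxFree k = ¬¬-excluded-middle λ where
  (yes B∈FOL) → k (inj₁ (nec (FOLDer⇒FOL□ (proj₂ B∈FOL))))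
  (no B∉FOL)  → k (inj₂ (nonFOL boxFree B∉FOL))

□-settled-≃ : A ≃ A' → BoxFree A' → ¬ ¬ Settled (□ A)
□-settled-≃ e boxFree k = □-settled-boxFree boxFree λ s → k (settled-≃ (□-cong e) s)

≃-boxFree : ∀ A → ¬ ¬ (Σ[ A' ∈ Formula ] BoxFree A' × A ≃ A')
≃-boxFree (pred p n xs) k = k (pred p n xs , tt , ⇒-refl , ⇒-refl)
≃-boxFree (u ≐ w)       k = k (u ≐ w , tt , ⇒-refl , ⇒-refl)
≃-boxFree (¬' A)        k = ≃-boxFree A λ (A' , bf , e) → k (¬' A' , bf , ¬-cong e)
≃-boxFree (A ⇒ B)       k = ≃-boxFree A λ (A' , bfA , eA) → ≃-boxFree B λ (B' , bfB , eB) →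
  k (A' ⇒ B' , (bfA , bfB) , ⇒-cong-≃ eA eB)
≃-boxFree (∀' x A)      k = ≃-boxFree A λ (A' , bf , e) → k (∀' x A' , bf , ∀-cong e)
≃-boxFree (□ A)         k = ≃-boxFree A λ (A' , bf , e) → □-settled-≃ e bf λ s →
  k (settled-≃-boxFree s)

□-settled : ∀ A → ¬ ¬ Settled (□ A)
□-settled A k = ≃-boxFree A λ (A' , bf , e) → □-settled-≃ e bf k

conj-∷ : ∀ B Bs → conj (B ∷ Bs) ≃ B ∧' conj Bs
conj-∷ B []      = ∧-intro ⇒-refl (weaken ⇒-refl) , ∧-proj₁
conj-∷ B (_ ∷ _) = ⇒-refl , ⇒-refl

insert : Formula → FSet → FSet
insert C Δ B = Δ B ⊎ B ≡ C

remove-theorem : FOL□ C → ∀ {Δ} Bs → AllIn Bs (insert C Δ) →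
                 Σ[ Bs' ∈ List Formula ] AllIn Bs' Δ × FOL□ (conj Bs' ⇒ conj Bs)
remove-theorem ⊢C [] _ = [] , tt , ⇒-refl
remove-theorem ⊢C (B ∷ Bs) (inj₁ B∈Δ , Bs∈) =
  let Bs' , Bs'∈Δ , p = remove-theorem ⊢C Bs Bs∈
  in  B ∷ Bs' , (B∈Δ , Bs'∈Δ) ,
      proj₁ (conj-∷ B Bs') ⨾ ∧-intro ∧-proj₁ (∧-proj₂ ⨾ p) ⨾ proj₂ (conj-∷ B Bs)
remove-theorem ⊢C (B ∷ Bs) (inj₂ refl , Bs∈) =
  let Bs' , Bs'∈Δ , p = remove-theorem ⊢C Bs Bs∈
  in  Bs' , Bs'∈Δ , ∧-intro (weaken ⊢C) p ⨾ proj₂ (conj-∷ B Bs)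

insert-theorem-consistent : ∀ {Δ} → FOL□ C → Consistent Δ → Consistent (insert C Δ)
insert-theorem-consistent ⊢C consistent Bs Bs∈ ⊢¬conj =
  let Bs' , Bs'∈Δ , p = remove-theorem ⊢C Bs Bs∈
  in  consistent Bs' Bs'∈Δ (mp (contraposition p) ⊢¬conj)

refutable-∉ : ∀ {Γ} → Consistent Γ → FOL□ (¬' C) → ¬ Γ C
refutable-∉ consistent ⊢¬C C∈Γ = consistent (_ ∷ []) (C∈Γ , tt) ⊢¬C

maximal-∋ : ∀ {Δ} → MaxConsistent Δ → Consistent (insert C Δ) → Δ C
maximal-∋ (_ , maximal) consistent = maximal _ inj₁ consistent (inj₂ refl)

□-transfer : ∀ {Γ Δ} → Consistent Γ → MaxConsistent Δ → Γ (□ A) → Δ (□ A)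
□-transfer {A} consΓ maxΔ □A∈Γ = maximal-∋ maxΔ λ Bs Bs∈ ⊢¬conj → □-settled A λ where
  (inj₁ ⊢□A)  → insert-theorem-consistent ⊢□A (proj₁ maxΔ) Bs Bs∈ ⊢¬conj
  (inj₂ ⊢¬□A) → refutable-∉ consΓ ⊢¬□A □A∈Γ

lemma6 : (A : Formula) (Γ Δ : FSet) → MC Γ → MC Δ → (Γ (□ A) ⇔ Δ (□ A))
lemma6 A Γ Δ (_ , maxΓ) (_ , maxΔ) =
  mk⇔ (□-transfer (proj₁ maxΓ) maxΔ) (□-transfer (proj₁ maxΔ) maxΓ)
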